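{- Let $L$ be a set of letters. For a $\mathcal{R}$-bilinear map $\diamond:\mathcal{R}L\times\mathcal{R}L\to\mathcal{R}\langle L\rangle$, we have \begin{align*} x\hat{\mathbin{\sqcup\!\sqcup}} y=x\overline{\mathbin{\sqcup\!\sqcup}} y \end{align*} for $x,y\in\mathcal{R}\langle L\rangle$.
   Context: $\mathcal{R}$ is a commutative ring with unit containing $\mathbb{Q}$, $\mathcal{R}\langle L\rangle$ the non-commutative polynomial ring in $L$, ${\bf 1}$ the empty word. $F$ (resp. $\overline{F}$) is the $\mathcal{R}$-linear map sending a word to its first (resp. last) letter and ${\bf 1}\mapsto{\bf 1}$; $R$ (resp. $\overline{R}$) sends a linear combination of words to the sum (like terms collected, coefficients dropped) of the words with the first (resp. last) letter removed. The generalized quasi-shuffle product is defined for non-empty words by $x\hat{\mathbin{\sqcup\!\sqcup}} y=F(x)(R(x)\hat{\mathbin{\sqcup\!\sqcup}} y)+F(y)(x\hat{\mathbin{\sqcup\!\sqcup}} R(y))+(F(x)\diamond F(y))(R(x)\hat{\mathbin{\sqcup\!\sqcup}} R(y))$, and the generalized dual product by $x\overline{\mathbin{\sqcup\!\sqcup}} y=(\overline{R}(x)\overline{\mathbin{\sqcup\!\sqcup}} y)\overline{F}(x)+(x\overline{\mathbin{\sqcup\!\sqcup}}\overline{R}(y))\overline{F}(y)+(\overline{R}(x)\overline{\mathbin{\sqcup\!\sqcup}}\overline{R}(y))(\overline{F}(x)\diamond\overline{F}(y))$; both have ${\bf 1}$ as unit and are extended bilinearly. -}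

module Defs where

open import Level using (Level; _⊔_)
open import Algebra.Bundles using (CommutativeRing)
open import Data.List using (List; []; _∷_; _++_; map; concatMap; reverse; foldr)
open import Data.Product using (_×_; _,_; ∃)
open import Data.Nat using (ℕ; zero; suc)
open import Relation.Nullary using (¬_)

module Poly {c ℓ a : Level} (𝓡 : CommutativeRing c ℓ) (L : Set a) where
  open CommutativeRing 𝓡 renaming (Carrier to R)

  Word : Set a
  Word = List L

  -- elements of R⟨L⟩ as finite formal R-linear combinations of words
  RL⟨⟩ : Set (c ⊔ a)
  RL⟨⟩ = List (R × Word)

  ⟦_⟧ : Word → RL⟨⟩
  ⟦ w ⟧ = (1# , w) ∷ []

  scale : R → RL⟨⟩ → RL⟨⟩
  scale r = map (λ { (e , w) → (r * e , w) })

  _⊗_ : RL⟨⟩ → RL⟨⟩ → RL⟨⟩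
  p ⊗ q = concatMap (λ { (e , u) → map (λ { (f , v) → (e * f , u ++ v) }) q }) p

  ev : (Word → R) → RL⟨⟩ → R
  ev φ = foldr (λ { (e , w) acc → e * φ w + acc }) 0#

  -- equality in the free R-module R⟨L⟩: equal images under every linear functional
  -- (a linear functional on the free module on words is the same as a function on words)
  _≈P_ : RL⟨⟩ → RL⟨⟩ → Set (c ⊔ ℓ ⊔ a)
  p ≈P q = (φ : Word → R) → ev φ p ≈ ev φ q

  bilin : (Word → Word → RL⟨⟩) → RL⟨⟩ → RL⟨⟩ → RL⟨⟩
  bilin f p q = concatMap (λ { (e , u) → concatMap (λ { (g , v) → scale (e * g) (f u v) }) q }) p

  -- A bilinear map ⋄ : RL × RL → R⟨L⟩ is given by its values on pairs of letters: d a b = a ⋄ b.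
  module Products (d : L → L → RL⟨⟩) where

    qsh : Word → Word → RL⟨⟩
    qsh [] y = ⟦ y ⟧
    qsh (a ∷ x) [] = ⟦ a ∷ x ⟧
    qsh (a ∷ x) (b ∷ y) =
      (⟦ a ∷ [] ⟧ ⊗ qsh x (b ∷ y)) ++ ((⟦ b ∷ [] ⟧ ⊗ qsh (a ∷ x) y) ++ (d a b ⊗ qsh x y))

    -- generalized dual product, computed on reversed words:
    -- dshRev rx ry = (reverse rx) ⊔̄ (reverse ry); the head of rx is the last letter of reverse rx
    dshRev : Word → Word → RL⟨⟩
    dshRev [] ry = ⟦ reverse ry ⟧
    dshRev (a ∷ rx) [] = ⟦ reverse (a ∷ rx) ⟧
    dshRev (a ∷ rx) (b ∷ ry) =
      (dshRev rx (b ∷ ry) ⊗ ⟦ a ∷ [] ⟧) ++ ((dshRev (a ∷ rx) ry ⊗ ⟦ b ∷ [] ⟧) ++ (dshRev rx ry ⊗ d a b))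

    dsh : Word → Word → RL⟨⟩
    dsh x y = dshRev (reverse x) (reverse y)

    _⊔̂_ : RL⟨⟩ → RL⟨⟩ → RL⟨⟩
    _⊔̂_ = bilin qsh

    _⊔̄_ : RL⟨⟩ → RL⟨⟩ → RL⟨⟩
    _⊔̄_ = bilin dsh

-- "𝓡 contains ℚ": 1 ≠ 0 and every positive integer is invertible
module _ {c ℓ : Level} (𝓡 : CommutativeRing c ℓ) where
  open CommutativeRing 𝓡 renaming (Carrier to R)

  natR : ℕ → R
  natR zero = 0#
  natR (suc n) = 1# + natR n

  ContainsℚAlg : Set (c ⊔ ℓ)
  ContainsℚAlg = (¬ (1# ≈ 0#)) × ((n : ℕ) → ∃ λ y → natR (suc n) * y ≈ 1#)

{-# OPTIONS --safe #-}

-- Both products are bilinear extensions of products of words, and the dual product is the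
-- quasi-shuffle recursion read at the right end of the words.  So it suffices that the
-- quasi-shuffle also obeys the right-end recursion
--   (u a) ⊔̂ (v b) = (u ⊔̂ v b) a + (u a ⊔̂ v) b + (u ⊔̂ v) (a ⋄ b),
-- which follows by induction from its left-end definition: expanding a product of words first
-- at the left end and then at the right end gives the same nine terms as the opposite order,
-- since left and right multiplication commute (front-back-interchange).  Polynomials are
-- compared through all functionals ev φ, which turns the module laws into ring identities.
module Submission where

open import Defs
open import Level using (Level; _⊔_)
open import Algebra.Bundles using (CommutativeRing; CommutativeMonoid)
open import Data.List using ([]; _∷_; _++_; map; concatMap; reverse; _∷ʳ_)
open import Data.List.Properties using (++-assoc; ++-identityʳ; unfold-reverse; reverse-involutive)
open import Data.Product using (_×_; _,_)
open import Function using (_∘_; id)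
open import Relation.Binary.Bundles using (Setoid)
open import Relation.Binary.Structures using (IsEquivalence)
open import Relation.Binary.PropositionalEquality as ≡ using (_≡_)
import Relation.Binary.Reasoning.Setoid as ≈-Reasoning
import Algebra.Properties.CommutativeSemigroup as CommSemigroupProperties
import Algebra.Solver.CommutativeMonoid as CommMonoidSolver

module _ {c ℓ 𝓁 : Level} (𝓡 : CommutativeRing c ℓ) (L : Set 𝓁) where
  open CommutativeRing 𝓡 renaming (Carrier to R)
  open Poly 𝓡 L

  ev-cong : ∀ {φ ψ : Word → R} → (∀ w → φ w ≈ ψ w) → ∀ p → ev φ p ≈ ev ψ p
  ev-cong φ≈ψ [] = refl
  ev-cong φ≈ψ ((e , w) ∷ p) = +-cong (*-congˡ (φ≈ψ w)) (ev-cong φ≈ψ p)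

  ev-++ : ∀ (φ : Word → R) p q → ev φ (p ++ q) ≈ ev φ p + ev φ q
  ev-++ φ [] q = sym (+-identityˡ _)
  ev-++ φ ((e , w) ∷ p) q = trans (+-congˡ (ev-++ φ p q)) (sym (+-assoc _ _ _))

  ev-+ : ∀ (φ ψ : Word → R) p → ev (λ w → φ w + ψ w) p ≈ ev φ p + ev ψ p
  ev-+ φ ψ [] = sym (+-identityˡ 0#)
  ev-+ φ ψ ((e , w) ∷ p) =
    trans (+-cong (distribˡ e (φ w) (ψ w)) (ev-+ φ ψ p)) (+-interchange _ _ _ _)
    where open CommSemigroupProperties +-commutativeSemigroup using () renaming (interchange to +-interchange)

  ev-⟦⟧ : ∀ (φ : Word → R) w → ev φ ⟦ w ⟧ ≈ φ w
  ev-⟦⟧ φ w = trans (+-identityʳ _) (*-identityˡ _)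

  ev-map : ∀ (φ : Word → R) r (s : Word → Word) {h : R × Word → R × Word} →
           (∀ e w → h (e , w) ≡ (r * e , s w)) → ∀ p → ev φ (map h p) ≈ r * ev (φ ∘ s) p
  ev-map φ r s h-def [] = sym (zeroʳ r)
  ev-map φ r s h-def ((e , w) ∷ p) rewrite h-def e w =
    trans (+-cong (*-assoc r e (φ (s w))) (ev-map φ r s h-def p)) (sym (distribˡ r _ _))

  ev-scale : ∀ (φ : Word → R) r p → ev φ (scale r p) ≈ r * ev φ p
  ev-scale φ r = ev-map φ r id (λ _ _ → ≡.refl)

  ev-⊗ : ∀ (φ : Word → R) p q → ev φ (p ⊗ q) ≈ ev (λ u → ev (φ ∘ (u ++_)) q) p
  ev-⊗ φ [] q = refl
  ev-⊗ φ ((e , u) ∷ p) q =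
    trans (ev-++ φ (map (λ { (f , v) → (e * f , u ++ v) }) q) (p ⊗ q))
          (+-cong (ev-map φ e (u ++_) (λ _ _ → ≡.refl) q) (ev-⊗ φ p q))

  -- _≈P_ unfolds to a function type, from which Agda cannot infer the two polynomials;
  -- this wrapper makes them inferable.
  infix 4 _≃_
  record _≃_ (p q : RL⟨⟩) : Set (c ⊔ ℓ ⊔ 𝓁) where
    constructor mk≃
    field ≃⇒≈P : p ≈P q
  open _≃_ public

  ≃-isEquivalence : IsEquivalence _≃_
  ≃-isEquivalence = record
    { refl  = mk≃ λ φ → refl
    ; sym   = λ (mk≃ p≈q) → mk≃ λ φ → sym (p≈q φ)
    ; trans = λ (mk≃ p≈q) (mk≃ q≈r) → mk≃ λ φ → trans (p≈q φ) (q≈r φ)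
    }

  ≃-setoid : Setoid (c ⊔ 𝓁) (c ⊔ ℓ ⊔ 𝓁)
  ≃-setoid = record { isEquivalence = ≃-isEquivalence }

  open Setoid ≃-setoid public
    using () renaming (refl to ≃-refl; sym to ≃-sym; trans to ≃-trans; reflexive to ≡⇒≃)

  ++-cong : ∀ {p p′ q q′} → p ≃ p′ → q ≃ q′ → p ++ q ≃ p′ ++ q′
  ++-cong {p} {p′} {q} {q′} (mk≃ p≈p′) (mk≃ q≈q′) = mk≃ λ φ →
    trans (ev-++ φ p q) (trans (+-cong (p≈p′ φ) (q≈q′ φ)) (sym (ev-++ φ p′ q′)))

  ++-congˡ : ∀ p {q q′} → q ≃ q′ → p ++ q ≃ p ++ q′
  ++-congˡ p = ++-cong (≃-refl {p})

  ++-comm : ∀ p q → p ++ q ≃ q ++ p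
  ++-comm p q = mk≃ λ φ → trans (ev-++ φ p q) (trans (+-comm _ _) (sym (ev-++ φ q p)))

  ++-commutativeMonoid : CommutativeMonoid (c ⊔ 𝓁) (c ⊔ ℓ ⊔ 𝓁)
  ++-commutativeMonoid = record
    { _≈_ = _≃_
    ; _∙_ = _++_
    ; ε = []
    ; isCommutativeMonoid = record
      { isMonoid = record
        { isSemigroup = record
          { isMagma = record { isEquivalence = ≃-isEquivalence ; ∙-cong = ++-cong }
          ; assoc = λ p q r → ≡⇒≃ (++-assoc p q r)
          }
        ; identity = (λ p → ≃-refl) , (λ p → ≡⇒≃ (++-identityʳ p))
        }
      ; comm = ++-comm
      }
    }

  ⊗-congʳ : ∀ {p p′} q → p ≃ p′ → p ⊗ q ≃ p′ ⊗ q
  ⊗-congʳ {p} {p′} q (mk≃ p≈p′) = mk≃ λ φ →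
    trans (ev-⊗ φ p q) (trans (p≈p′ _) (sym (ev-⊗ φ p′ q)))

  ⊗-congˡ : ∀ p {q q′} → q ≃ q′ → p ⊗ q ≃ p ⊗ q′
  ⊗-congˡ p {q} {q′} (mk≃ q≈q′) = mk≃ λ φ →
    trans (ev-⊗ φ p q) (trans (ev-cong (λ u → q≈q′ (φ ∘ (u ++_))) p) (sym (ev-⊗ φ p q′)))

  ⊗-assoc : ∀ p q r → (p ⊗ q) ⊗ r ≃ p ⊗ (q ⊗ r)
  ⊗-assoc p q r = mk≃ λ φ → begin
    ev φ ((p ⊗ q) ⊗ r)                                             ≈⟨ ev-⊗ φ (p ⊗ q) r ⟩
    ev (λ w → ev (φ ∘ (w ++_)) r) (p ⊗ q)                          ≈⟨ ev-⊗ _ p q ⟩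
    ev (λ u → ev (λ v → ev (φ ∘ ((u ++ v) ++_)) r) q) p
      ≈⟨ ev-cong (λ u → ev-cong (λ v → ev-cong (λ t → reflexive (≡.cong φ (++-assoc u v t))) r) q) p ⟩
    ev (λ u → ev (λ v → ev (φ ∘ (u ++_) ∘ (v ++_)) r) q) p          ≈⟨ ev-cong (λ u → ev-⊗ _ q r) p ⟨
    ev (λ u → ev (φ ∘ (u ++_)) (q ⊗ r)) p                          ≈⟨ ev-⊗ φ p (q ⊗ r) ⟨
    ev φ (p ⊗ (q ⊗ r))                                             ∎
    where open ≈-Reasoning setoid

  ⊗-distribʳ-++ : ∀ p q r → (p ++ q) ⊗ r ≃ p ⊗ r ++ q ⊗ r
  ⊗-distribʳ-++ p q r = mk≃ λ φ → begin
    ev φ ((p ++ q) ⊗ r)                                    ≈⟨ ev-⊗ φ (p ++ q) r ⟩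
    ev (λ u → ev (φ ∘ (u ++_)) r) (p ++ q)                 ≈⟨ ev-++ _ p q ⟩
    ev (λ u → ev (φ ∘ (u ++_)) r) p + ev (λ u → ev (φ ∘ (u ++_)) r) q
      ≈⟨ +-cong (ev-⊗ φ p r) (ev-⊗ φ q r) ⟨
    ev φ (p ⊗ r) + ev φ (q ⊗ r)                            ≈⟨ ev-++ φ (p ⊗ r) (q ⊗ r) ⟨
    ev φ (p ⊗ r ++ q ⊗ r)                                  ∎
    where open ≈-Reasoning setoid

  ⊗-distribˡ-++ : ∀ p q r → p ⊗ (q ++ r) ≃ p ⊗ q ++ p ⊗ r
  ⊗-distribˡ-++ p q r = mk≃ λ φ → begin
    ev φ (p ⊗ (q ++ r))                                    ≈⟨ ev-⊗ φ p (q ++ r) ⟩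
    ev (λ u → ev (φ ∘ (u ++_)) (q ++ r)) p                 ≈⟨ ev-cong (λ u → ev-++ (φ ∘ (u ++_)) q r) p ⟩
    ev (λ u → ev (φ ∘ (u ++_)) q + ev (φ ∘ (u ++_)) r) p   ≈⟨ ev-+ _ _ p ⟩
    ev (λ u → ev (φ ∘ (u ++_)) q) p + ev (λ u → ev (φ ∘ (u ++_)) r) p
      ≈⟨ +-cong (ev-⊗ φ p q) (ev-⊗ φ p r) ⟨
    ev φ (p ⊗ q) + ev φ (p ⊗ r)                            ≈⟨ ev-++ φ (p ⊗ q) (p ⊗ r) ⟨
    ev φ (p ⊗ q ++ p ⊗ r)                                  ∎
    where open ≈-Reasoning setoid

  ⊗-zeroʳ : ∀ p → p ⊗ [] ≡ []
  ⊗-zeroʳ [] = ≡.refl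
  ⊗-zeroʳ (_ ∷ p) = ⊗-zeroʳ p

  ⟦⟧-⊗-⟦⟧ : ∀ u v → ⟦ u ⟧ ⊗ ⟦ v ⟧ ≃ ⟦ u ++ v ⟧
  ⟦⟧-⊗-⟦⟧ u v = mk≃ λ φ → +-congʳ (*-congʳ (*-identityˡ 1#))

  ⊗-identityˡ : ∀ p → ⟦ [] ⟧ ⊗ p ≃ p
  ⊗-identityˡ p = mk≃ λ φ → trans (ev-⊗ φ ⟦ [] ⟧ p) (ev-⟦⟧ (λ u → ev (φ ∘ (u ++_)) p) [])

  ⊗-identityʳ : ∀ p → p ⊗ ⟦ [] ⟧ ≃ p
  ⊗-identityʳ p = mk≃ λ φ → trans (ev-⊗ φ p ⟦ [] ⟧)
    (ev-cong (λ u → trans (ev-⟦⟧ (φ ∘ (u ++_)) []) (reflexive (≡.cong φ (++-identityʳ u)))) p)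

  -- The summands [] and p ⊗ [] are zero entries, padding a single word to the
  -- three-summand shape of front and back below.
  ⟦∷ʳ⟧-padded : ∀ w a → ⟦ w ∷ʳ a ⟧ ≃ ⟦ w ⟧ ⊗ ⟦ a ∷ [] ⟧ ++ []
  ⟦∷ʳ⟧-padded w a = ≃-sym (≃-trans (≡⇒≃ (++-identityʳ _)) (⟦⟧-⊗-⟦⟧ w (a ∷ [])))

  ⟦∷⟧-padded : ∀ a w p → ⟦ a ∷ [] ⟧ ⊗ ⟦ w ⟧ ++ p ⊗ [] ≃ ⟦ a ∷ w ⟧
  ⟦∷⟧-padded a w p rewrite ⊗-zeroʳ p = ≃-trans (≡⇒≃ (++-identityʳ _)) (⟦⟧-⊗-⟦⟧ (a ∷ []) w)

  scale-cong : ∀ r {p q} → p ≃ q → scale r p ≃ scale r q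
  scale-cong r {p} {q} (mk≃ p≈q) = mk≃ λ φ →
    trans (ev-scale φ r p) (trans (*-congˡ (p≈q φ)) (sym (ev-scale φ r q)))

  concatMap-cong : ∀ {b} {A : Set b} {k k′ : A → RL⟨⟩} → (∀ x → k x ≃ k′ x) → ∀ xs →
                   concatMap k xs ≃ concatMap k′ xs
  concatMap-cong k≃k′ [] = ≃-refl
  concatMap-cong k≃k′ (x ∷ xs) = ++-cong (k≃k′ x) (concatMap-cong k≃k′ xs)

  bilin-cong : ∀ {f g : Word → Word → RL⟨⟩} → (∀ u v → f u v ≃ g u v) → ∀ p q →
               bilin f p q ≃ bilin g p q
  bilin-cong f≃g p q =
    concatMap-cong (λ (e , u) → concatMap-cong (λ (e′ , v) → scale-cong (e * e′) (f≃g u v)) q) p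

  module _ (d : L → L → RL⟨⟩) where
    open Products d

    front : L → L → RL⟨⟩ → RL⟨⟩ → RL⟨⟩ → RL⟨⟩
    front a b x y z = ⟦ a ∷ [] ⟧ ⊗ x ++ ⟦ b ∷ [] ⟧ ⊗ y ++ d a b ⊗ z

    back : L → L → RL⟨⟩ → RL⟨⟩ → RL⟨⟩ → RL⟨⟩
    back a b x y z = x ⊗ ⟦ a ∷ [] ⟧ ++ y ⊗ ⟦ b ∷ [] ⟧ ++ z ⊗ d a b

    front-cong : ∀ a b {x x′ y y′ z z′} → x ≃ x′ → y ≃ y′ → z ≃ z′ → front a b x y z ≃ front a b x′ y′ z′
    front-cong a b x≃x′ y≃y′ z≃z′ =
      ++-cong (⊗-congˡ ⟦ a ∷ [] ⟧ x≃x′) (++-cong (⊗-congˡ ⟦ b ∷ [] ⟧ y≃y′) (⊗-congˡ (d a b) z≃z′))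

    back-cong : ∀ a b {x x′ y y′ z z′} → x ≃ x′ → y ≃ y′ → z ≃ z′ → back a b x y z ≃ back a b x′ y′ z′
    back-cong a b x≃x′ y≃y′ z≃z′ =
      ++-cong (⊗-congʳ ⟦ a ∷ [] ⟧ x≃x′) (++-cong (⊗-congʳ ⟦ b ∷ [] ⟧ y≃y′) (⊗-congʳ (d a b) z≃z′))

    front-back-interchange : ∀ c e a b x₁₁ x₁₂ x₁₃ x₂₁ x₂₂ x₂₃ x₃₁ x₃₂ x₃₃ →
      front c e (back a b x₁₁ x₁₂ x₁₃) (back a b x₂₁ x₂₂ x₂₃) (back a b x₃₁ x₃₂ x₃₃) ≃
      back a b (front c e x₁₁ x₂₁ x₃₁) (front c e x₁₂ x₂₂ x₃₂) (front c e x₁₃ x₂₃ x₃₃)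
    front-back-interchange c e a b x₁₁ x₁₂ x₁₃ x₂₁ x₂₂ x₂₃ x₃₁ x₃₂ x₃₃ =
      ≃-trans (++-cong (row p₁ x₁₁ x₁₂ x₁₃) (++-cong (row p₂ x₂₁ x₂₂ x₂₃) (row p₃ x₃₁ x₃₂ x₃₃)))
      (≃-trans (transpose ((p₁ ⊗ x₁₁) ⊗ r₁) ((p₁ ⊗ x₁₂) ⊗ r₂) ((p₁ ⊗ x₁₃) ⊗ r₃)
                          ((p₂ ⊗ x₂₁) ⊗ r₁) ((p₂ ⊗ x₂₂) ⊗ r₂) ((p₂ ⊗ x₂₃) ⊗ r₃)
                          ((p₃ ⊗ x₃₁) ⊗ r₁) ((p₃ ⊗ x₃₂) ⊗ r₂) ((p₃ ⊗ x₃₃) ⊗ r₃))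
               (≃-sym (++-cong (column r₁ x₁₁ x₂₁ x₃₁) (++-cong (column r₂ x₁₂ x₂₂ x₃₂) (column r₃ x₁₃ x₂₃ x₃₃)))))
      where
      p₁ p₂ p₃ r₁ r₂ r₃ : RL⟨⟩
      p₁ = ⟦ c ∷ [] ⟧
      p₂ = ⟦ e ∷ [] ⟧
      p₃ = d c e
      r₁ = ⟦ a ∷ [] ⟧
      r₂ = ⟦ b ∷ [] ⟧
      r₃ = d a b
      row : ∀ p x y z → p ⊗ back a b x y z ≃ (p ⊗ x) ⊗ r₁ ++ (p ⊗ y) ⊗ r₂ ++ (p ⊗ z) ⊗ r₃
      row p x y z =
        ≃-trans (⊗-distribˡ-++ p (x ⊗ r₁) _)
          (++-cong (≃-sym (⊗-assoc p x r₁))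
            (≃-trans (⊗-distribˡ-++ p (y ⊗ r₂) (z ⊗ r₃))
              (++-cong (≃-sym (⊗-assoc p y r₂)) (≃-sym (⊗-assoc p z r₃)))))
      column : ∀ r x y z → front c e x y z ⊗ r ≃ (p₁ ⊗ x) ⊗ r ++ (p₂ ⊗ y) ⊗ r ++ (p₃ ⊗ z) ⊗ r
      column r x y z =
        ≃-trans (⊗-distribʳ-++ (p₁ ⊗ x) _ r) (++-congˡ ((p₁ ⊗ x) ⊗ r) (⊗-distribʳ-++ (p₂ ⊗ y) (p₃ ⊗ z) r))
      transpose : ∀ a b c d e f g h i →
        (a ++ b ++ c) ++ (d ++ e ++ f) ++ (g ++ h ++ i) ≃ (a ++ d ++ g) ++ (b ++ e ++ h) ++ (c ++ f ++ i)
      transpose = solve 9 (λ a b c d e f g h i →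
        ((a ⊕ b ⊕ c) ⊕ (d ⊕ e ⊕ f) ⊕ (g ⊕ h ⊕ i)) ⊜ ((a ⊕ d ⊕ g) ⊕ (b ⊕ e ⊕ h) ⊕ (c ⊕ f ⊕ i))) ≃-refl
        where open CommMonoidSolver ++-commutativeMonoid using (solve; _⊜_; _⊕_)

    qsh-[]ʳ : ∀ x → qsh x [] ≡ ⟦ x ⟧
    qsh-[]ʳ [] = ≡.refl
    qsh-[]ʳ (_ ∷ _) = ≡.refl

    qsh-∷ʳ-[] : ∀ x a → qsh (x ∷ʳ a) [] ≃ qsh x [] ⊗ ⟦ a ∷ [] ⟧ ++ []
    qsh-∷ʳ-[] x a rewrite qsh-[]ʳ (x ∷ʳ a) | qsh-[]ʳ x = ⟦∷ʳ⟧-padded x a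

    qsh-∷-[] : ∀ a x p → ⟦ a ∷ [] ⟧ ⊗ qsh x [] ++ p ⊗ [] ≃ qsh (a ∷ x) []
    qsh-∷-[] a x p rewrite qsh-[]ʳ x = ⟦∷⟧-padded a x p

    qsh-∷ʳ : ∀ u v a b → qsh (u ∷ʳ a) (v ∷ʳ b) ≃ back a b (qsh u (v ∷ʳ b)) (qsh (u ∷ʳ a) v) (qsh u v)
    qsh-∷ʳ [] [] a b = begin
      ⟦ a ∷ [] ⟧ ⊗ ⟦ b ∷ [] ⟧ ++ ⟦ b ∷ [] ⟧ ⊗ ⟦ a ∷ [] ⟧ ++ d a b ⊗ ⟦ [] ⟧
        ≈⟨ x∙yz≈y∙xz (⟦ a ∷ [] ⟧ ⊗ ⟦ b ∷ [] ⟧) (⟦ b ∷ [] ⟧ ⊗ ⟦ a ∷ [] ⟧) (d a b ⊗ ⟦ [] ⟧) ⟩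
      ⟦ b ∷ [] ⟧ ⊗ ⟦ a ∷ [] ⟧ ++ ⟦ a ∷ [] ⟧ ⊗ ⟦ b ∷ [] ⟧ ++ d a b ⊗ ⟦ [] ⟧
        ≈⟨ ++-congˡ (⟦ b ∷ [] ⟧ ⊗ ⟦ a ∷ [] ⟧) (++-congˡ (⟦ a ∷ [] ⟧ ⊗ ⟦ b ∷ [] ⟧)
             (≃-trans (⊗-identityʳ (d a b)) (≃-sym (⊗-identityˡ (d a b))))) ⟩
      ⟦ b ∷ [] ⟧ ⊗ ⟦ a ∷ [] ⟧ ++ ⟦ a ∷ [] ⟧ ⊗ ⟦ b ∷ [] ⟧ ++ ⟦ [] ⟧ ⊗ d a b
        ∎
      where
      open ≈-Reasoning ≃-setoid
      open CommSemigroupProperties (CommutativeMonoid.commutativeSemigroup ++-commutativeMonoid)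
        using (x∙yz≈y∙xz)
    qsh-∷ʳ (c ∷ u) [] a b =
      ≃-trans (front-cong c b (qsh-∷ʳ u [] a b) (⟦∷ʳ⟧-padded (c ∷ u) a) (qsh-∷ʳ-[] u a))
      (≃-trans (front-back-interchange c b a b
                  (qsh u (b ∷ [])) (qsh (u ∷ʳ a) []) (qsh u [])
                  ⟦ c ∷ u ⟧        []                []
                  (qsh u [])       []                [])
               (back-cong a b (≃-refl {qsh (c ∷ u) (b ∷ [])}) (qsh-∷-[] c (u ∷ʳ a) (d c b)) (qsh-∷-[] c u (d c b))))
    qsh-∷ʳ [] (e ∷ v) a b =
      ≃-trans (front-cong a e (⟦∷ʳ⟧-padded (e ∷ v) b) (qsh-∷ʳ [] v a b) (⟦∷ʳ⟧-padded v b))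
      (≃-trans (front-back-interchange a e a b
                  []                 ⟦ e ∷ v ⟧        []
                  ⟦ v ∷ʳ b ⟧         (qsh (a ∷ []) v) ⟦ v ⟧
                  []                 ⟦ v ⟧            [])
               (back-cong a b (⟦∷⟧-padded e (v ∷ʳ b) (d a e)) (≃-refl {qsh (a ∷ []) (e ∷ v)}) (⟦∷⟧-padded e v (d a e))))
    qsh-∷ʳ (c ∷ u) (e ∷ v) a b =
      ≃-trans (front-cong c e (qsh-∷ʳ u (e ∷ v) a b) (qsh-∷ʳ (c ∷ u) v a b) (qsh-∷ʳ u v a b))
              (front-back-interchange c e a b
                  (qsh u (e ∷ v ∷ʳ b))   (qsh (u ∷ʳ a) (e ∷ v))   (qsh u (e ∷ v))
                  (qsh (c ∷ u) (v ∷ʳ b)) (qsh (c ∷ u ∷ʳ a) v)     (qsh (c ∷ u) v)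
                  (qsh u (v ∷ʳ b))       (qsh (u ∷ʳ a) v)         (qsh u v))

    dshRev-≃-qsh : ∀ rx ry → dshRev rx ry ≃ qsh (reverse rx) (reverse ry)
    dshRev-≃-qsh [] ry = ≃-refl
    dshRev-≃-qsh (a ∷ rx) [] = ≡⇒≃ (≡.sym (qsh-[]ʳ (reverse (a ∷ rx))))
    dshRev-≃-qsh (a ∷ rx) (b ∷ ry) = begin
      dshRev (a ∷ rx) (b ∷ ry)
        ≈⟨ back-cong a b (dshRev-≃-qsh rx (b ∷ ry)) (dshRev-≃-qsh (a ∷ rx) ry) (dshRev-≃-qsh rx ry) ⟩
      back a b (qsh x (reverse (b ∷ ry))) (qsh (reverse (a ∷ rx)) y) (qsh x y)
        ≡⟨ ≡.cong₂ (λ y′ x′ → back a b (qsh x y′) (qsh x′ y) (qsh x y)) (unfold-reverse b ry) (unfold-reverse a rx) ⟩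
      back a b (qsh x (y ∷ʳ b)) (qsh (x ∷ʳ a) y) (qsh x y)
        ≈⟨ qsh-∷ʳ x y a b ⟨
      qsh (x ∷ʳ a) (y ∷ʳ b)
        ≡⟨ ≡.cong₂ qsh (unfold-reverse a rx) (unfold-reverse b ry) ⟨
      qsh (reverse (a ∷ rx)) (reverse (b ∷ ry))
        ∎
      where
      open ≈-Reasoning ≃-setoid
      x y : Word
      x = reverse rx
      y = reverse ry

    qsh-≃-dsh : ∀ x y → qsh x y ≃ dsh x y
    qsh-≃-dsh x y = ≃-sym (≃-trans (dshRev-≃-qsh (reverse x) (reverse y))
                                   (≡⇒≃ (≡.cong₂ qsh (reverse-involutive x) (reverse-involutive y))))

    ⊔̂-≃-⊔̄ : ∀ p q → p ⊔̂ q ≃ p ⊔̄ q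
    ⊔̂-≃-⊔̄ = bilin-cong qsh-≃-dsh

lemma3p6 : {c ℓ a : Level} (𝓡 : CommutativeRing c ℓ) → ContainsℚAlg 𝓡 → (L : Set a) → (d : L → L → Poly.RL⟨⟩ 𝓡 L) → (x y : Poly.RL⟨⟩ 𝓡 L) → Poly._≈P_ 𝓡 L (Poly.Products._⊔̂_ 𝓡 L d x y) (Poly.Products._⊔̄_ 𝓡 L d x y)
lemma3p6 𝓡 _ L d x y = ≃⇒≈P (⊔̂-≃-⊔̄ 𝓡 L d x y)
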